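{- Let $\mathcal C_n$ be the set of permutations in $\mathfrak S_n$ avoiding $1\text{ - }2\text{ - }34$ and $2\text{ - }1\text{ - }3$. Label each $\pi\in\mathcal C_n$ by $(m(\pi),\pi_n)$. Then $1\in\mathcal C_1$ has label $(2,1)$, and for $\pi\in\mathcal C_n$ with label $(m,r)$ the multiset of labels of its children in $\mathcal C_{n+1}$ is: $(m+1,1),(2,2)$ if $r=1$; $(3,1),(2,2),(2,3)$ if $m=r=2$; and $(m+1,1),(2,2),(m,m+1),\dots,(m,r)$ if $m<r$.
   Context: $\mathfrak S_n$ is the set of permutations $\pi=\pi_1\cdots\pi_n$ of $\{1,\dots,n\}$. $\pi$ avoids $2\text{ - }1\text{ - }3$ if there are no $i<j<k$ with $\pi_j<\pi_i<\pi_k$; $\pi$ avoids $1\text{ - }2\text{ - }34$ if there are no $i<j<k$ with $\pi_i<\pi_j<\pi_k<\pi_{k+1}$. For $\pi\in\mathfrak S_n$ and $j\in\{1,\dots,n+1\}$, appending $j$ to $\pi$ gives the permutation of $\{1,\dots,n+1\}$ whose first $n$ entries are $\pi_i$ if $\pi_i<j$ and $\pi_i+1$ if $\pi_i\ge j$, and whose last entry is $j$. The children of $\pi\in\mathcal C_n$ are the permutations obtained by appending some $j$ to $\pi$ that lie in $\mathcal C_{n+1}$. $m(\pi)=n+1$ if $\pi=n(n-1)\cdots21$, and otherwise $m(\pi)=\min\{\pi_i:\exists j<i\text{ with }\pi_j<\pi_i\}$. -}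

module Defs where

open import Data.Nat using (ℕ; zero; suc; _<_; _≤_; _∸_; _+_; _<ᵇ_; _⊓_; _≟_)
open import Data.Bool using (Bool; true; false; if_then_else_; _∨_)
open import Data.List using (List; []; _∷_; _++_; [_]; map; upTo; downFrom; length; foldr; concatMap)
open import Data.List.Properties using (≡-dec)
open import Data.List.Relation.Binary.Permutation.Propositional using (_↭_)
open import Data.List.Membership.Propositional using (_∈_)
open import Data.List.Relation.Unary.Unique.Propositional using (Unique)
open import Data.Product using (_×_; _,_; ∃-syntax)
open import Relation.Nullary using (¬_; does)
open import Relation.Binary.PropositionalEquality using (_≡_)
open import Function.Bundles using (_⇔_)

-- Permutations of {1,…,n} are lists of naturals (one-line notation).
-- Entry π_{i+1} is `at π i` (0-based index; out-of-range gives 0, never used).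
at : List ℕ → ℕ → ℕ
at []       _       = 0
at (x ∷ xs) zero    = x
at (x ∷ xs) (suc i) = at xs i

oneTo : ℕ → List ℕ
oneTo n = map suc (upTo n)

IsPerm : ℕ → List ℕ → Set
IsPerm n π = π ↭ oneTo n

Avoids213 : List ℕ → Set
Avoids213 π = ∀ i j k → i < j → j < k → k < length π →
  ¬ (at π j < at π i × at π i < at π k)

Avoids1-2-34 : List ℕ → Set
Avoids1-2-34 π = ∀ i j k → i < j → j < k → suc k < length π →
  ¬ (at π i < at π j × at π j < at π k × at π k < at π (suc k))

C : ℕ → List ℕ → Set
C n π = IsPerm n π × Avoids1-2-34 π × Avoids213 π

append : ℕ → List ℕ → List ℕ
append j π = map (λ x → if x <ᵇ j then x else suc x) π ++ [ j ]

IsChild : ℕ → List ℕ → List ℕ → Set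
IsChild n π σ = (∃[ j ] (1 ≤ j × j ≤ suc n × σ ≡ append j π)) × C (suc n) σ

down : ℕ → List ℕ
down n = map suc (downFrom n)

anyB : (ℕ → Bool) → List ℕ → Bool
anyB p []       = false
anyB p (x ∷ xs) = p x ∨ anyB p xs

ascTops : List ℕ → List ℕ
ascTops π = concatMap
  (λ i → if anyB (λ j → at π j <ᵇ at π i) (upTo i) then [ at π i ] else [])
  (upTo (length π))

m : List ℕ → ℕ
m π = if does (≡-dec _≟_ π (down (length π)))
        then suc (length π)
        else foldr _⊓_ (suc (length π)) (ascTops π)

lastEntry : List ℕ → ℕ
lastEntry π = at π (length π ∸ 1)

Label : Set
Label = ℕ × ℕ

label : List ℕ → Label
label π = (m π , lastEntry π)

labelsFromTo : ℕ → ℕ → ℕ → List Label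
labelsFromTo a b c = map (λ i → (a , suc b + i)) (upTo (c ∸ b))

-- "the multiset of labels of the children of π ∈ 𝒞_n is L":
-- the children, listed without repetition, have label multiset L
ChildLabels : ℕ → List ℕ → List Label → Set
ChildLabels n π L = ∃[ ch ] (Unique ch × (∀ σ → (σ ∈ ch) ⇔ IsChild n π σ) × map label ch ↭ L)

module Submission where

-- Every child of π ∈ 𝒞_n is `append j π` for some 1 ≤ j ≤ n+1.  Appending
-- relabels the old entries order-preservingly, so a new occurrence of a
-- pattern must end at the new entry j: a 2-1-3 ending at j is an inversion of
-- π whose larger entry is below j, and a 1-2-34 ending at j forces j ≥ 4.
-- For j ≥ 4 the values 1, 2, 3 would have to occur in increasing order, which
-- makes 3 the last entry of π and 1, 2, 3, j a 1-2-34; so only j ∈ {1,2,3}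
-- remain.  j = 1, 2 always give children and j = 3 does iff no 2 precedes a 1.
-- Appending 1 raises every entry, increasing m by one; after appending 2, or 3
-- when 1 precedes 2, the ascent 1…2 gives m = 2.  If π_n = 1 the 2 precedes
-- the 1; if π_n ≥ 2 then 1 precedes 2, so m(π) = 2 and π_n ≤ 3, which turns
-- the case m < π_n into the case m = 2 = π_n - 1.

open import Defs
open import Data.Nat using (ℕ; zero; suc; _<_; _≤_; _∸_; _<ᵇ_; _⊓_; _≟_; z≤n; s≤s; _<?_)
open import Data.Nat.Properties
  using ( <ᵇ⇒<; <⇒<ᵇ; <⇒≢; <⇒≤; <⇒≱; ≮⇒≥; ≤-reflexive; ≤∧≢⇒<; <-irrefl; <-asym; ≤-pred
        ; ≤-refl; ≤-trans; <-trans; ≤-<-trans; <-≤-trans; ≤-antisym; <-cmp; n≤1+n; m≤m+n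
        ; suc-injective
        ; m<1+n⇒m<n∨m≡n; m⊓n≤m; m⊓n≤n; ⊓-glb; ∸-monoʳ-< )
open import Relation.Binary.Definitions using (tri<; tri≈; tri>)
open import Data.Bool using (Bool; true; false; if_then_else_; _∨_)
open import Data.Bool.Properties using (∨-zeroʳ; T-≡)
open import Data.List
  using (List; []; _∷_; _++_; [_]; map; upTo; downFrom; length; foldr; concat; concatMap)
open import Data.List.Properties
  using ( ≡-dec; length-map; length-upTo; length-downFrom; map-applyUpTo; map-∘; map-cong-local
        ; map-injective; map-concatMap; concatMap-++; upTo-∷ʳ; ++-identityʳ; ∷ʳ-injectiveˡ )
open import Data.List.Membership.Propositional using (_∈_; find; lose)
open import Data.List.Membership.Propositional.Properties
  using (∈-map⁺; ∈-map⁻; ∈-upTo⁺; ∈-upTo⁻; ∈-concatMap⁺; ∈-concatMap⁻)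
open import Data.List.Relation.Unary.Any using (here; there)
open import Data.List.Relation.Unary.All as All using (All; []; _∷_)
open import Data.List.Relation.Unary.AllPairs using ([]; _∷_)
open import Data.List.Relation.Unary.Unique.Propositional using (Unique)
import Data.List.Relation.Unary.Unique.Propositional.Properties as Unique
open import Data.List.Relation.Binary.Permutation.Propositional
  using (_↭_; ↭-refl; ↭-sym; ↭-prep; ↭-reflexive; ↭⇒↭ₛ; module PermutationReasoning)
open import Data.List.Relation.Binary.Permutation.Propositional.Properties
  using (∈-resp-↭; ↭-length; ++⁺ʳ; ++-comm) renaming (map⁺ to ↭-map⁺)
open import Data.List.Relation.Binary.Permutation.Setoid.Properties using (Unique-resp-↭)
open import Data.Product using (_×_; _,_; ∃-syntax; proj₁; proj₂)
open import Data.Sum using (_⊎_; inj₁; inj₂)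
open import Data.Empty using (⊥; ⊥-elim)
open import Function.Bundles using (Equivalence; _⇔_; mk⇔)
open import Relation.Nullary using (¬_; Dec; yes; no)
open import Relation.Binary.PropositionalEquality
  using (_≡_; _≢_; refl; sym; cong; cong₂; subst; subst₂; trans; setoid; module ≡-Reasoning)

at-∈ : ∀ xs i → i < length xs → at xs i ∈ xs
at-∈ (x ∷ xs) zero    _       = here refl
at-∈ (x ∷ xs) (suc i) (s≤s p) = there (at-∈ xs i p)

∈⇒at : ∀ {x} xs → x ∈ xs → ∃[ i ] (i < length xs × at xs i ≡ x)
∈⇒at (y ∷ xs) (here refl) = zero , s≤s z≤n , refl
∈⇒at (y ∷ xs) (there p) with ∈⇒at xs p
... | i , i< , e = suc i , s≤s i< , e

Unique⇒at-injective : ∀ xs → Unique xs → ∀ i k → i < length xs → k < length xs →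
  at xs i ≡ at xs k → i ≡ k
Unique⇒at-injective (x ∷ xs) (x∉ ∷ u) zero    zero    _       _       _ = refl
Unique⇒at-injective (x ∷ xs) (x∉ ∷ u) zero    (suc k) _       (s≤s q) e =
  ⊥-elim (All.lookup x∉ (at-∈ xs k q) e)
Unique⇒at-injective (x ∷ xs) (x∉ ∷ u) (suc i) zero    (s≤s p) _       e =
  ⊥-elim (All.lookup x∉ (at-∈ xs i p) (sym e))
Unique⇒at-injective (x ∷ xs) (x∉ ∷ u) (suc i) (suc k) (s≤s p) (s≤s q) e =
  cong suc (Unique⇒at-injective xs u i k p q e)

distinct-positions : ∀ π {a b} → at π a ≢ at π b → a < b ⊎ b < a
distinct-positions π {a} {b} ne with <-cmp a b
... | tri< a<b _ _ = inj₁ a<b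
... | tri≈ _ refl _ = ⊥-elim (ne refl)
... | tri> _ _ b<a = inj₂ b<a

record PermFacts (n : ℕ) (π : List ℕ) : Set where
  field
    length≡     : length π ≡ n
    entry-pos   : ∀ i → i < length π → 1 ≤ at π i
    entry-bound : ∀ i → i < length π → at π i ≤ n
    position    : ∀ v → 1 ≤ v → v ≤ n → ∃[ i ] (i < length π × at π i ≡ v)
    injective   : ∀ i k → i < length π → k < length π → at π i ≡ at π k → i ≡ k

permFacts : ∀ {n π} → IsPerm n π → PermFacts n π
permFacts {n} {π} p = record
  { length≡     = trans (↭-length p) (trans (length-map suc (upTo n)) (length-upTo n))
  ; entry-pos   = λ i i< → proj₁ (in-range (entry∈ i i<))
  ; entry-bound = λ i i< → proj₂ (in-range (entry∈ i i<))
  ; position    = position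
  ; injective   = Unique⇒at-injective π (Unique-resp-↭ (setoid ℕ) (↭⇒↭ₛ (↭-sym p)) unique-oneTo)
  }
  where
  entry∈ : ∀ i → i < length π → at π i ∈ oneTo n
  entry∈ i i< = ∈-resp-↭ p (at-∈ π i i<)
  in-range : ∀ {x} → x ∈ oneTo n → 1 ≤ x × x ≤ n
  in-range x∈ with ∈-map⁻ suc x∈
  ... | y , y∈ , refl = s≤s z≤n , ∈-upTo⁻ y∈
  unique-oneTo : Unique (oneTo n)
  unique-oneTo = Unique.map⁺ suc-injective (Unique.upTo⁺ n)
  position : ∀ v → 1 ≤ v → v ≤ n → ∃[ i ] (i < length π × at π i ≡ v)
  position (suc w) _ w<n = ∈⇒at π (∈-resp-↭ (↭-sym p) (∈-map⁺ suc (∈-upTo⁺ w<n)))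

-- Appending j relabels every old entry x by `shift j x`: entries below j are
-- kept and the others move up by one to make room for the new last entry j.
shift : ℕ → ℕ → ℕ
shift j x = if x <ᵇ j then x else suc x

shift-below : ∀ {j x} → x < j → shift j x ≡ x
shift-below {j} {x} x<j with x <ᵇ j | <⇒<ᵇ x<j
... | true | _ = refl    -- the test cannot be false: it is proved true by <⇒<ᵇ

shift-above : ∀ {j x} → j ≤ x → shift j x ≡ suc x
shift-above {j} {x} j≤x with x <ᵇ j in x<ᵇj
... | true  = ⊥-elim (<⇒≱ (<ᵇ⇒< x j (Equivalence.from T-≡ x<ᵇj)) j≤x)
... | false = refl

shift-cases : ∀ j x → (x < j × shift j x ≡ x) ⊎ (j ≤ x × shift j x ≡ suc x)
shift-cases j x with x <? j
... | yes x<j = inj₁ (x<j , shift-below x<j)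
... | no  x≮j = inj₂ (≮⇒≥ x≮j , shift-above (≮⇒≥ x≮j))

shift-increasing : ∀ j x → x ≤ shift j x
shift-increasing j x with shift-cases j x
... | inj₁ (_ , e) = subst (x ≤_) (sym e) ≤-refl
... | inj₂ (_ , e) = subst (x ≤_) (sym e) (n≤1+n x)

-- The relabelling is order preserving, so patterns among old entries survive
-- appending unchanged.
shift-reflects-< : ∀ j {a b} → shift j a < shift j b → a < b
shift-reflects-< j {a} {b} lt with shift-cases j a | shift-cases j b
... | inj₁ (_ , ea) | inj₁ (_ , eb)     = subst₂ _<_ ea eb lt
... | inj₁ (a<j , _) | inj₂ (j≤b , _)  = <-≤-trans a<j j≤b
... | inj₂ (j≤a , ea) | inj₁ (b<j , eb) =
  ⊥-elim (<⇒≱ (<-≤-trans b<j j≤a) (≤-trans (n≤1+n a) (<⇒≤ (subst₂ _<_ ea eb lt))))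
... | inj₂ (_ , ea) | inj₂ (_ , eb)     = ≤-pred (subst₂ _<_ ea eb lt)

shift-suc : ∀ j x → shift (suc j) (suc x) ≡ suc (shift j x)
shift-suc j x with x <ᵇ j
... | true  = refl
... | false = refl

length-append : ∀ j π → length (append j π) ≡ suc (length π)
length-append j []      = refl
length-append j (x ∷ π) = cong suc (length-append j π)

at-append : ∀ j π i → i < length π → at (append j π) i ≡ shift j (at π i)
at-append j (x ∷ π) zero    _       = refl
at-append j (x ∷ π) (suc i) (s≤s p) = at-append j π i p

at-append-last : ∀ j π → at (append j π) (length π) ≡ j
at-append-last j []      = refl
at-append-last j (x ∷ π) = at-append-last j π

lastEntry-append : ∀ j π → lastEntry (append j π) ≡ j
lastEntry-append j π =
  subst (λ L → at (append j π) (L ∸ 1) ≡ j) (sym (length-append j π)) (at-append-last j π)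

length<length-append : ∀ j π → length π < length (append j π)
length<length-append j π = subst (length π <_) (sym (length-append j π)) ≤-refl

append-injective : ∀ π {j k} → append j π ≡ append k π → j ≡ k
append-injective π {j} {k} e =
  trans (sym (lastEntry-append j π)) (trans (cong lastEntry e) (lastEntry-append k π))

append-suc : ∀ j xs → append (suc j) (map suc xs) ≡ map suc (append j xs)
append-suc j []       = refl
append-suc j (x ∷ xs) = cong₂ _∷_ (shift-suc j x) (append-suc j xs)

upTo-suc : ∀ n → upTo (suc n) ≡ 0 ∷ map suc (upTo n)
upTo-suc n = cong (0 ∷_) (sym (map-applyUpTo (λ x → x) suc n))

append-upTo : ∀ {j} n → j ≤ n → append j (upTo n) ↭ upTo (suc n)
append-upTo {zero} n _ = begin
  map suc (upTo n) ++ [ 0 ] ↭⟨ ++-comm (map suc (upTo n)) [ 0 ] ⟩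
  0 ∷ map suc (upTo n)      ≡⟨ sym (upTo-suc n) ⟩
  upTo (suc n)              ∎
  where open PermutationReasoning
append-upTo {suc j} (suc n) (s≤s j≤n) = begin
  append (suc j) (upTo (suc n))                ≡⟨ cong (append (suc j)) (upTo-suc n) ⟩
  0 ∷ append (suc j) (map suc (upTo n))        ≡⟨ cong (0 ∷_) (append-suc j (upTo n)) ⟩
  0 ∷ map suc (append j (upTo n))              ↭⟨ ↭-prep 0 (↭-map⁺ suc (append-upTo n j≤n)) ⟩
  0 ∷ map suc (upTo (suc n))                   ≡⟨ sym (upTo-suc (suc n)) ⟩
  upTo (suc (suc n))                           ∎
  where open PermutationReasoning

append-perm : ∀ {n π j} → IsPerm n π → 1 ≤ j → j ≤ suc n → IsPerm (suc n) (append j π)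
append-perm {n} {π} {suc j} p _ (s≤s j≤n) = begin
  append (suc j) π                     ↭⟨ ++⁺ʳ [ suc j ] (↭-map⁺ (shift (suc j)) p) ⟩
  append (suc j) (map suc (upTo n))    ≡⟨ append-suc j (upTo n) ⟩
  map suc (append j (upTo n))          ↭⟨ ↭-map⁺ suc (append-upTo n j≤n) ⟩
  oneTo (suc n)                        ∎
  where open PermutationReasoning

append-reflects-< : ∀ j π {i k} → i < length π → k < length π →
  at (append j π) i < at (append j π) k → at π i < at π k
append-reflects-< j π {i} {k} i< k< lt =
  shift-reflects-< j (subst₂ _<_ (at-append j π i i<) (at-append j π k k<) lt)

append-keeps-below : ∀ j π {i} → i < length π → at π i < j → at (append j π) i ≡ at π i
append-keeps-below j π {i} i< below = trans (at-append j π i i<) (shift-below below)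

InversionTopsFrom : ℕ → List ℕ → Set
InversionTopsFrom j π = ∀ i k → i < k → k < length π → at π k < at π i → j ≤ at π i

-- A 2-1-3 in `append j π` either lies among the old entries, or ends at the new
-- entry j and then starts with an inversion of π whose larger entry is below j.
append-avoids213 : ∀ j π → Avoids213 π → InversionTopsFrom j π → Avoids213 (append j π)
append-avoids213 j π av tops i i' k i<i' i'<k k< (p , q)
  with m<1+n⇒m<n∨m≡n (subst (k <_) (length-append j π) k<)
... | inj₁ k<n = av i i' k i<i' i'<k k<n
  (append-reflects-< j π i'<n i<n p , append-reflects-< j π i<n k<n q)
  where
  i'<n : i' < length π
  i'<n = <-trans i'<k k<n
  i<n : i < length π
  i<n = <-trans i<i' i'<n
... | inj₂ refl = <⇒≱ πi<j (tops i i' i<i' i'<k (append-reflects-< j π i'<k i<n p))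
  where
  i<n : i < length π
  i<n = <-trans i<i' i'<k
  πi<j : at π i < j
  πi<j = ≤-<-trans (shift-increasing j (at π i))
           (subst₂ _<_ (at-append j π i i<n) (at-append-last j π) q)

inversion-below⇒213 : ∀ j π {i k} → i < k → k < length π → at π k < at π i → at π i < j →
  ¬ Avoids213 (append j π)
inversion-below⇒213 j π {i} {k} i<k k< inv below av =
  av i k (length π) i<k k< (length<length-append j π)
    ( subst₂ _<_ (sym (append-keeps-below j π k< (<-trans inv below)))
                 (sym (append-keeps-below j π i< below)) inv
    , subst₂ _<_ (sym (append-keeps-below j π i< below)) (sym (at-append-last j π)) below )
  where
  i< : i < length π
  i< = <-trans i<k k<

-- A 1-2-34 ending at the new entry j needs three smaller positive entries
-- before j, so for j ≤ 3 only old occurrences are possible.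
append-avoids1-2-34 : ∀ j π → j ≤ 3 → (∀ i → i < length π → 1 ≤ at π i) →
  Avoids1-2-34 π → Avoids1-2-34 (append j π)
append-avoids1-2-34 j π j≤3 pos av i i' k i<i' i'<k sk< (p , q , r)
  with m<1+n⇒m<n∨m≡n (subst (suc k <_) (length-append j π) sk<)
... | inj₁ sk<n = av i i' k i<i' i'<k sk<n
  (append-reflects-< j π i<n i'<n p , append-reflects-< j π i'<n k<n q ,
   append-reflects-< j π k<n sk<n r)
  where
  k<n : k < length π
  k<n = <-trans ≤-refl sk<n
  i'<n : i' < length π
  i'<n = <-trans i'<k k<n
  i<n : i < length π
  i<n = <-trans i<i' i'<n
... | inj₂ sk≡n = <⇒≱ (s≤s j≤3) 4≤j
  where
  i<n : i < length π
  i<n = <-trans i<i' (<-trans i'<k (subst (k <_) sk≡n ≤-refl))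
  1≤σi : 1 ≤ at (append j π) i
  1≤σi = ≤-trans (pos i i<n)
           (subst (at π i ≤_) (sym (at-append j π i i<n)) (shift-increasing j _))
  -- 1 ≤ σ_i < σ_i' < σ_k < σ_{k+1} = j
  4≤j : 4 ≤ j
  4≤j = subst (4 ≤_) (trans (cong (at (append j π)) sk≡n) (at-append-last j π))
          (≤-trans (s≤s (≤-trans (s≤s (≤-trans (s≤s 1≤σi) p)) q)) r)

increasing-to-end⇒1-2-34 : ∀ j π {i i' k} → i < i' → i' < k → suc k ≡ length π →
  at π i < at π i' → at π i' < at π k → at π k < j → ¬ Avoids1-2-34 (append j π)
increasing-to-end⇒1-2-34 j π {i} {i'} {k} i<i' i'<k sk≡n p q r av =
  av i i' k i<i' i'<k (subst (_< length (append j π)) (sym sk≡n) (length<length-append j π))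
    ( subst₂ _<_ (sym (keep i<n (<-trans p (<-trans q r)))) (sym (keep i'<n (<-trans q r))) p
    , subst₂ _<_ (sym (keep i'<n (<-trans q r))) (sym (keep k<n r)) q
    , subst₂ _<_ (sym (keep k<n r)) (sym (trans (cong (at (append j π)) sk≡n) (at-append-last j π))) r
    )
  where
  keep : ∀ {p} → p < length π → at π p < j → at (append j π) p ≡ at π p
  keep = append-keeps-below j π
  k<n : k < length π
  k<n = subst (k <_) sk≡n ≤-refl
  i'<n : i' < length π
  i'<n = <-trans i'<k k<n
  i<n : i < length π
  i<n = <-trans i<i' i'<n

anyB-true⁻ : ∀ (p : ℕ → Bool) xs → anyB p xs ≡ true → ∃[ x ] (x ∈ xs × p x ≡ true)
anyB-true⁻ p (x ∷ xs) e with p x in px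
... | true  = x , here refl , px
... | false with anyB-true⁻ p xs e
... | y , y∈ , py = y , there y∈ , py

anyB-true⁺ : ∀ (p : ℕ → Bool) xs {x} → x ∈ xs → p x ≡ true → anyB p xs ≡ true
anyB-true⁺ p (y ∷ xs) (here refl) px rewrite px = refl
anyB-true⁺ p (y ∷ xs) (there x∈) px rewrite anyB-true⁺ p xs x∈ px = ∨-zeroʳ (p y)

anyB-false : ∀ (p : ℕ → Bool) xs → (∀ x → x ∈ xs → p x ≡ false) → anyB p xs ≡ false
anyB-false p []       _ = refl
anyB-false p (x ∷ xs) h rewrite h x (here refl) = anyB-false p xs (λ y y∈ → h y (there y∈))

anyB-cong : ∀ (p q : ℕ → Bool) xs → (∀ x → x ∈ xs → p x ≡ q x) → anyB p xs ≡ anyB q xs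
anyB-cong p q []       _ = refl
anyB-cong p q (x ∷ xs) h =
  cong₂ _∨_ (h x (here refl)) (anyB-cong p q xs (λ y y∈ → h y (there y∈)))

ascTop : List ℕ → ℕ → List ℕ
ascTop τ i = if anyB (λ j → at τ j <ᵇ at τ i) (upTo i) then [ at τ i ] else []

IsAscentTop : List ℕ → ℕ → Set
IsAscentTop τ x = ∃[ i ] ∃[ j ] (j < i × i < length τ × at τ j < at τ i × at τ i ≡ x)

ascTops-sound : ∀ τ {x} → x ∈ ascTops τ → IsAscentTop τ x
ascTops-sound τ {x} x∈ with find (∈-concatMap⁻ (ascTop τ) x∈)
... | i , i∈ , x∈top with anyB (λ j → at τ j <ᵇ at τ i) (upTo i) in found | x∈top
... | true | here refl with anyB-true⁻ (λ j → at τ j <ᵇ at τ i) (upTo i) found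
... | j , j∈ , lt =
  i , j , ∈-upTo⁻ j∈ , ∈-upTo⁻ i∈ , <ᵇ⇒< _ _ (Equivalence.from T-≡ lt) , refl

ascTops-complete : ∀ τ {x} → IsAscentTop τ x → x ∈ ascTops τ
ascTops-complete τ (i , j , j<i , i< , lt , refl) =
  ∈-concatMap⁺ (ascTop τ) (lose (∈-upTo⁺ i<) top-listed)
  where
  found : anyB (λ j → at τ j <ᵇ at τ i) (upTo i) ≡ true
  found = anyB-true⁺ _ (upTo i) (∈-upTo⁺ j<i) (Equivalence.to T-≡ (<⇒<ᵇ lt))
  top-listed : at τ i ∈ ascTop τ i
  top-listed = subst (λ b → at τ i ∈ (if b then [ at τ i ] else [])) (sym found) (here refl)

foldr-⊓-≤ : ∀ b L {a} → a ∈ L → foldr _⊓_ b L ≤ a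
foldr-⊓-≤ b (x ∷ L) (here refl) = m⊓n≤m x _
foldr-⊓-≤ b (x ∷ L) (there a∈) = ≤-trans (m⊓n≤n x _) (foldr-⊓-≤ b L a∈)

foldr-⊓-≥ : ∀ b L {a} → a ≤ b → All (a ≤_) L → a ≤ foldr _⊓_ b L
foldr-⊓-≥ b []      a≤b []          = a≤b
foldr-⊓-≥ b (x ∷ L) a≤b (a≤x ∷ a≤L) = ⊓-glb a≤x (foldr-⊓-≥ b L a≤b a≤L)

foldr-⊓-suc : ∀ b L → foldr _⊓_ (suc b) (map suc L) ≡ suc (foldr _⊓_ b L)
foldr-⊓-suc b []      = refl
foldr-⊓-suc b (x ∷ L) = cong (suc x ⊓_) (foldr-⊓-suc b L)

length-down : ∀ L → length (down L) ≡ L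
length-down L = trans (length-map suc (downFrom L)) (length-downFrom L)

at-down : ∀ L i → i < L → at (down L) i ≡ L ∸ i
at-down (suc L) zero    _       = refl
at-down (suc L) (suc i) (s≤s p) = at-down L i p

ascent⇒not-down : ∀ τ {i j} → j < i → i < length τ → at τ j < at τ i → τ ≢ down (length τ)
ascent⇒not-down τ {i} {j} j<i i< ascent τ≡down = <-asym ascent′ (∸-monoʳ-< j<i (<⇒≤ i<))
  where
  ascent′ : length τ ∸ j < length τ ∸ i
  ascent′ = subst₂ _<_ (at-down (length τ) j (<-trans j<i i<)) (at-down (length τ) i i<)
              (subst (λ σ → at σ j < at σ i) τ≡down ascent)

m-down : ∀ L → m (down L) ≡ suc L
m-down L with ≡-dec _≟_ (down L) (down (length (down L)))
... | yes _ = cong suc (length-down L)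
... | no ne = ⊥-elim (ne (cong down (sym (length-down L))))

m-not-down : ∀ τ → τ ≢ down (length τ) → m τ ≡ foldr _⊓_ (suc (length τ)) (ascTops τ)
m-not-down τ ne with ≡-dec _≟_ τ (down (length τ))
... | yes e = ⊥-elim (ne e)
... | no _  = refl

-- An ascent top exceeds another entry, hence is positive; so is m.
m-positive : ∀ τ → 1 ≤ m τ
m-positive τ with ≡-dec _≟_ τ (down (length τ))
... | yes _ = s≤s z≤n
... | no _  = foldr-⊓-≥ _ (ascTops τ) (s≤s z≤n)
                (All.tabulate (λ x∈ → top-positive (ascTops-sound τ x∈)))
  where
  top-positive : ∀ {x} → IsAscentTop τ x → 1 ≤ x
  top-positive (i , j , _ , _ , lt , refl) = ≤-trans (s≤s z≤n) lt

m-least : ∀ τ {a} → IsAscentTop τ a → (∀ {x} → IsAscentTop τ x → a ≤ x) →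
  a ≤ suc (length τ) → m τ ≡ a
m-least τ {a} top@(i , j , j<i , i< , ascent , _) least a≤ =
  trans (m-not-down τ (ascent⇒not-down τ j<i i< ascent))
    (≤-antisym (foldr-⊓-≤ _ (ascTops τ) (ascTops-complete τ top))
               (foldr-⊓-≥ _ (ascTops τ) a≤ (All.tabulate (λ x∈ → least (ascTops-sound τ x∈)))))

m-1-before-2 : ∀ τ → (∀ i → i < length τ → 1 ≤ at τ i) →
  ∀ {p q} → p < q → q < length τ → at τ p ≡ 1 → at τ q ≡ 2 → m τ ≡ 2
m-1-before-2 τ pos {p} {q} p<q q< τp≡1 τq≡2 =
  m-least τ (q , p , p<q , q< , subst₂ _<_ (sym τp≡1) (sym τq≡2) ≤-refl , τq≡2) least
    (s≤s (≤-trans (s≤s z≤n) (≤-trans p<q (<⇒≤ q<))))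
  where
  least : ∀ {x} → IsAscentTop τ x → 2 ≤ x
  least (i , j , j<i , i< , lt , refl) = ≤-trans (s≤s (pos j (<-trans j<i i<))) lt

raise : List ℕ → List ℕ
raise τ = map suc τ ++ [ 1 ]

length-raise : ∀ τ → length (raise τ) ≡ suc (length τ)
length-raise []      = refl
length-raise (x ∷ τ) = cong suc (length-raise τ)

at-raise : ∀ τ i → i < length τ → at (raise τ) i ≡ suc (at τ i)
at-raise (x ∷ τ) zero    _       = refl
at-raise (x ∷ τ) (suc i) (s≤s p) = at-raise τ i p

at-raise-last : ∀ τ → at (raise τ) (length τ) ≡ 1
at-raise-last []      = refl
at-raise-last (x ∷ τ) = at-raise-last τ

append-1≡raise : ∀ π → (∀ i → i < length π → 1 ≤ at π i) → append 1 π ≡ raise π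
append-1≡raise []      _   = refl
append-1≡raise (x ∷ π) pos =
  cong₂ _∷_ (shift-above (pos 0 (s≤s z≤n))) (append-1≡raise π (λ i i< → pos (suc i) (s≤s i<)))

raise-down : ∀ L → raise (down L) ≡ down (suc L)
raise-down zero    = refl
raise-down (suc L) = cong (suc (suc L) ∷_) (raise-down L)

raise-injective : ∀ {τ τ′} → raise τ ≡ raise τ′ → τ ≡ τ′
raise-injective {τ} {τ′} e =
  map-injective suc-injective (∷ʳ-injectiveˡ (map suc τ) (map suc τ′) e)

-- Old positions keep their ascent status; the final 1 is never an ascent top.
ascTop-raise : ∀ τ i → i < length τ → ascTop (raise τ) i ≡ map suc (ascTop τ i)
ascTop-raise τ i i< = begin
  ascTop (raise τ) i
    ≡⟨ cong₂ (λ b y → if b then [ y ] else []) (anyB-cong _ _ (upTo i) earlier) (at-raise τ i i<) ⟩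
  (if anyB (λ j → at τ j <ᵇ at τ i) (upTo i) then [ suc (at τ i) ] else [])
    ≡⟨ map-if (anyB (λ j → at τ j <ᵇ at τ i) (upTo i)) ⟩
  map suc (ascTop τ i) ∎
  where
  open ≡-Reasoning
  earlier : ∀ j → j ∈ upTo i → (at (raise τ) j <ᵇ at (raise τ) i) ≡ (at τ j <ᵇ at τ i)
  earlier j j∈ = cong₂ _<ᵇ_ (at-raise τ j (<-trans (∈-upTo⁻ j∈) i<)) (at-raise τ i i<)
  map-if : ∀ b → (if b then [ suc (at τ i) ] else []) ≡ map suc (if b then [ at τ i ] else [])
  map-if true  = refl
  map-if false = refl

ascTop-raise-last : ∀ τ → ascTop (raise τ) (length τ) ≡ []
ascTop-raise-last τ =
  cong (λ b → if b then [ at (raise τ) (length τ) ] else []) (anyB-false _ (upTo (length τ)) below-1)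
  where
  below-1 : ∀ j → j ∈ upTo (length τ) → (at (raise τ) j <ᵇ at (raise τ) (length τ)) ≡ false
  below-1 j j∈ rewrite at-raise τ j (∈-upTo⁻ j∈) | at-raise-last τ = refl

ascTops-raise : ∀ τ → ascTops (raise τ) ≡ map suc (ascTops τ)
ascTops-raise τ = begin
  concatMap (ascTop (raise τ)) (upTo (length (raise τ)))
    ≡⟨ cong (λ L → concatMap (ascTop (raise τ)) (upTo L)) (length-raise τ) ⟩
  concatMap (ascTop (raise τ)) (upTo (suc (length τ)))
    ≡⟨ cong (concatMap (ascTop (raise τ))) (sym (upTo-∷ʳ (length τ))) ⟩
  concatMap (ascTop (raise τ)) (upTo (length τ) ++ [ length τ ])
    ≡⟨ concatMap-++ (ascTop (raise τ)) (upTo (length τ)) [ length τ ] ⟩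
  concatMap (ascTop (raise τ)) (upTo (length τ)) ++ (ascTop (raise τ) (length τ) ++ [])
    ≡⟨ cong (λ t → prefix ++ (t ++ [])) (ascTop-raise-last τ) ⟩
  concatMap (ascTop (raise τ)) (upTo (length τ)) ++ []
    ≡⟨ ++-identityʳ _ ⟩
  concatMap (ascTop (raise τ)) (upTo (length τ))
    ≡⟨ cong concat (map-cong-local (All.tabulate (λ i∈ → ascTop-raise τ _ (∈-upTo⁻ i∈)))) ⟩
  concatMap (λ i → map suc (ascTop τ i)) (upTo (length τ))
    ≡⟨ sym (map-concatMap suc (ascTop τ) (upTo (length τ))) ⟩
  map suc (ascTops τ) ∎
  where
  open ≡-Reasoning
  prefix : List ℕ
  prefix = concatMap (ascTop (raise τ)) (upTo (length τ))

m-raise : ∀ τ → m (raise τ) ≡ suc (m τ)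
m-raise τ = by-cases (≡-dec _≟_ τ (down (length τ)))
  where
  open ≡-Reasoning
  L : ℕ
  L = length τ
  by-cases : Dec (τ ≡ down L) → m (raise τ) ≡ suc (m τ)
  by-cases (yes τ≡down) = begin
    m (raise τ)          ≡⟨ cong m (trans (cong raise τ≡down) (raise-down L)) ⟩
    m (down (suc L))     ≡⟨ m-down (suc L) ⟩
    suc (suc L)          ≡⟨ cong suc (sym (trans (cong m τ≡down) (m-down L))) ⟩
    suc (m τ)            ∎
  by-cases (no τ≢down) = begin
    m (raise τ)
      ≡⟨ m-not-down (raise τ) raise≢down ⟩
    foldr _⊓_ (suc (length (raise τ))) (ascTops (raise τ))
      ≡⟨ cong₂ (λ l t → foldr _⊓_ (suc l) t) (length-raise τ) (ascTops-raise τ) ⟩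
    foldr _⊓_ (suc (suc L)) (map suc (ascTops τ))
      ≡⟨ foldr-⊓-suc (suc L) (ascTops τ) ⟩
    suc (foldr _⊓_ (suc L) (ascTops τ))
      ≡⟨ cong suc (sym (m-not-down τ τ≢down)) ⟩
    suc (m τ) ∎
    where
    raise≢down : raise τ ≢ down (length (raise τ))
    raise≢down e =
      τ≢down (raise-injective (trans e (trans (cong down (length-raise τ)) (sym (raise-down L)))))

childLabels-by-values : ∀ n π (js : List ℕ) {L : List Label} → Unique js →
  (∀ {j} → j ∈ js → IsChild n π (append j π)) →
  (∀ {j} → 1 ≤ j → j ≤ suc n → C (suc n) (append j π) → j ∈ js) →
  map (λ j → label (append j π)) js ≡ L → ChildLabels n π L
childLabels-by-values n π js {L} unique sound complete labels =
  map (λ j → append j π) js , Unique.map⁺ (append-injective π) unique , members ,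
  ↭-reflexive (trans (sym (map-∘ js)) labels)
  where
  members : ∀ σ → (σ ∈ map (λ j → append j π) js) ⇔ IsChild n π σ
  members σ = mk⇔ to from
    where
    to : σ ∈ map (λ j → append j π) js → IsChild n π σ
    to σ∈ with ∈-map⁻ (λ j → append j π) σ∈
    ... | j , j∈ , refl = sound j∈
    from : IsChild n π σ → σ ∈ map (λ j → append j π) js
    from ((j , 1≤j , j≤ , refl) , cσ) = ∈-map⁺ (λ j → append j π) (complete 1≤j j≤ cσ)

4≤-of-≢123 : ∀ {y} → 1 ≤ y → y ≢ 1 → y ≢ 2 → y ≢ 3 → 4 ≤ y
4≤-of-≢123 {1} _ ≢1 _ _ = ⊥-elim (≢1 refl)
4≤-of-≢123 {2} _ _ ≢2 _ = ⊥-elim (≢2 refl)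
4≤-of-≢123 {3} _ _ _ ≢3 = ⊥-elim (≢3 refl)
4≤-of-≢123 {suc (suc (suc (suc y)))} _ _ _ _ = s≤s (s≤s (s≤s (s≤s z≤n)))

Precedes : List ℕ → ℕ → ℕ → Set
Precedes π u v = ∃[ p ] ∃[ q ] (p < q × q < length π × at π p ≡ u × at π q ≡ v)

-- Throughout, π ∈ 𝒞_n with n = n' + 1; its last entry r = π_n sits at position n'.
module Structure (n' : ℕ) (π : List ℕ) (c : C (suc n') π) where
  open PermFacts (permFacts (proj₁ c))

  avoids1-2-34 : Avoids1-2-34 π
  avoids1-2-34 = proj₁ (proj₂ c)

  avoids213 : Avoids213 π
  avoids213 = proj₂ (proj₂ c)

  last-position : suc n' ≡ length π
  last-position = sym length≡

  n'<length : n' < length π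
  n'<length = subst (n' <_) last-position ≤-refl

  r : ℕ
  r = at π n'

  lastEntry≡r : lastEntry π ≡ r
  lastEntry≡r = cong (λ L → at π (L ∸ 1)) length≡

  r≤n : r ≤ suc n'
  r≤n = entry-bound n' n'<length

  before-last : ∀ {p} → p < length π → at π p ≢ r → p < n'
  before-last {p} p< ≢r with m<1+n⇒m<n∨m≡n (subst (p <_) length≡ p<)
  ... | inj₁ p<n' = p<n'
  ... | inj₂ refl = ⊥-elim (≢r refl)

  increasing-below : ∀ {j u v p q} → u < v → v < j → p < length π → q < length π →
    at π p ≡ u → at π q ≡ v → Avoids213 (append j π) → p < q
  increasing-below {j} u<v v<j p< q< πp≡u πq≡v av
    with distinct-positions π (λ e → <⇒≢ u<v (trans (sym πp≡u) (trans e πq≡v)))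
  ... | inj₁ p<q = p<q
  ... | inj₂ q<p = ⊥-elim (inversion-below⇒213 j π q<p p<
          (subst₂ _<_ (sym πp≡u) (sym πq≡v) u<v) (subst (_< j) (sym πq≡v) v<j) av)

  -- If 1, 2, 3 occur in this order, then 3 is the last entry: the entry after
  -- 3 would be at least 4 and complete a 1-2-34.
  1-2-3-ends : ∀ {p₁ p₂ p₃} → p₁ < p₂ → p₂ < p₃ → p₃ < length π →
    at π p₁ ≡ 1 → at π p₂ ≡ 2 → at π p₃ ≡ 3 → p₃ ≡ n'
  1-2-3-ends {p₁} {p₂} {p₃} p₁<p₂ p₂<p₃ p₃< e₁ e₂ e₃
    with m<1+n⇒m<n∨m≡n (subst (p₃ <_) length≡ p₃<)
  ... | inj₂ p₃≡n' = p₃≡n'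
  ... | inj₁ p₃<n' = ⊥-elim (avoids1-2-34 p₁ p₂ p₃ p₁<p₂ p₂<p₃ next<
          (subst₂ _<_ (sym e₁) (sym e₂) ≤-refl , subst₂ _<_ (sym e₂) (sym e₃) ≤-refl ,
           subst (_< at π (suc p₃)) (sym e₃) next≥4))
    where
    next< : suc p₃ < length π
    next< = subst (suc p₃ <_) last-position (s≤s p₃<n')
    next-new : ∀ {p} → p ≤ p₃ → at π (suc p₃) ≢ at π p
    next-new p≤p₃ e =
      <⇒≱ (s≤s p≤p₃) (≤-reflexive (injective _ _ next< (≤-<-trans p≤p₃ p₃<) e))
    next≥4 : 4 ≤ at π (suc p₃)
    next≥4 = 4≤-of-≢123 (entry-pos _ next<)
      (λ e → next-new (<⇒≤ (<-trans p₁<p₂ p₂<p₃)) (trans e (sym e₁)))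
      (λ e → next-new (<⇒≤ p₂<p₃) (trans e (sym e₂)))
      (λ e → next-new ≤-refl (trans e (sym e₃)))

  -- No j ≥ 4 can be appended: 1, 2, 3 (all below j) must then occur in this
  -- order, so 3 is last in π and 1, 2, 3, j is a 1-2-34.
  append-≥4-not-in-C : ∀ {j} → 4 ≤ j → j ≤ suc (suc n') → ¬ C (suc (suc n')) (append j π)
  append-≥4-not-in-C {j} 4≤j j≤ (_ , av1-2-34 , av213)
    with position 1 (s≤s z≤n) 1≤n | position 2 (s≤s z≤n) 2≤n | position 3 (s≤s z≤n) 3≤n
    where
    3≤n : 3 ≤ suc n'
    3≤n = ≤-pred (≤-trans 4≤j j≤)
    2≤n : 2 ≤ suc n'
    2≤n = ≤-trans (n≤1+n 2) 3≤n
    1≤n : 1 ≤ suc n'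
    1≤n = ≤-trans (n≤1+n 1) 2≤n
  ... | p₁ , p₁< , e₁ | p₂ , p₂< , e₂ | p₃ , p₃< , e₃ =
    increasing-to-end⇒1-2-34 j π p₁<p₂ p₂<p₃
      (trans (cong suc (1-2-3-ends p₁<p₂ p₂<p₃ p₃< e₁ e₂ e₃)) last-position)
      (subst₂ _<_ (sym e₁) (sym e₂) ≤-refl) (subst₂ _<_ (sym e₂) (sym e₃) ≤-refl)
      (subst (_< j) (sym e₃) 4≤j) av1-2-34
    where
    p₁<p₂ : p₁ < p₂
    p₁<p₂ = increasing-below ≤-refl (<-trans ≤-refl 4≤j) p₁< p₂< e₁ e₂ av213
    p₂<p₃ : p₂ < p₃
    p₂<p₃ = increasing-below ≤-refl 4≤j p₂< p₃< e₂ e₃ av213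

  -- Appending j ≤ 3 stays in 𝒞 as soon as no inversion of π has its larger
  -- entry below j (the only way a 2-1-3 could appear).
  append-child : ∀ {j} → 1 ≤ j → j ≤ 3 → j ≤ suc (suc n') → InversionTopsFrom j π →
    IsChild (suc n') π (append j π)
  append-child {j} 1≤j j≤3 j≤ tops =
    (j , 1≤j , j≤ , refl) , append-perm (proj₁ c) 1≤j j≤ ,
    append-avoids1-2-34 j π j≤3 entry-pos avoids1-2-34 , append-avoids213 j π avoids213 tops

  -- The larger entry of an inversion exceeds a positive entry, so it is ≥ 2.
  inversion-tops-from-2 : InversionTopsFrom 2 π
  inversion-tops-from-2 i k i<k k< lt = ≤-trans (s≤s (entry-pos k k<)) lt

  -- If no 2 precedes a 1, an inversion cannot have larger entry 2.
  inversion-tops-from-3 : ¬ Precedes π 2 1 → InversionTopsFrom 3 π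
  inversion-tops-from-3 no21 i k i<k k< lt with at π i ≟ 2
  ... | no  πi≢2 = ≤∧≢⇒< (inversion-tops-from-2 i k i<k k< lt) (λ e → πi≢2 (sym e))
  ... | yes πi≡2 = ⊥-elim (no21 (i , k , i<k , k< , πi≡2 ,
          ≤-antisym (≤-pred (subst (at π k <_) πi≡2 lt)) (entry-pos k k<)))

  child-1 : IsChild (suc n') π (append 1 π)
  child-1 = append-child ≤-refl (s≤s z≤n) (s≤s z≤n) (λ i k i<k k< lt → ≤-trans (s≤s z≤n) lt)

  child-2 : IsChild (suc n') π (append 2 π)
  child-2 = append-child (s≤s z≤n) (s≤s (s≤s z≤n)) (s≤s (s≤s z≤n)) inversion-tops-from-2

  child-3 : 2 ≤ suc n' → ¬ Precedes π 2 1 → IsChild (suc n') π (append 3 π)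
  child-3 2≤n no21 = append-child (s≤s z≤n) ≤-refl (s≤s 2≤n) (inversion-tops-from-3 no21)

  append-positive : ∀ {j} → 1 ≤ j → j ≤ suc (suc n') →
    ∀ i → i < length (append j π) → 1 ≤ at (append j π) i
  append-positive 1≤j j≤ = PermFacts.entry-pos (permFacts (append-perm (proj₁ c) 1≤j j≤))

  -- Appending 1 raises every entry, hence raises m by one.
  label-1 : label (append 1 π) ≡ (suc (m π) , 1)
  label-1 = cong₂ _,_ (trans (cong m (append-1≡raise π entry-pos)) (m-raise π)) (lastEntry-append 1 π)

  -- After appending 2, the old 1 precedes the new final 2.
  label-2 : label (append 2 π) ≡ (2 , 2)
  label-2 with position 1 (s≤s z≤n) (s≤s z≤n)
  ... | p₁ , p₁< , e₁ = cong₂ _,_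
    (m-1-before-2 (append 2 π) (append-positive (s≤s z≤n) (s≤s (s≤s z≤n)))
      p₁< (length<length-append 2 π)
      (trans (append-keeps-below 2 π p₁< (subst (_< 2) (sym e₁) ≤-refl)) e₁) (at-append-last 2 π))
    (lastEntry-append 2 π)

  -- Appending 3 keeps 1 and 2 in place; if 1 precedes 2, m becomes 2.
  label-3 : 2 ≤ suc n' → Precedes π 1 2 → label (append 3 π) ≡ (2 , 3)
  label-3 2≤n (p , q , p<q , q< , e₁ , e₂) = cong₂ _,_
    (m-1-before-2 (append 3 π) (append-positive (s≤s z≤n) (s≤s 2≤n))
      p<q (<-trans q< (length<length-append 3 π))
      (trans (append-keeps-below 3 π (<-trans p<q q<) (subst (_< 3) (sym e₁) (s≤s (s≤s z≤n)))) e₁)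
      (trans (append-keeps-below 3 π q< (subst (_< 3) (sym e₂) ≤-refl)) e₂))
    (lastEntry-append 3 π)

  -- Case r = 1: the 2 comes before the final 1, so appending 3 creates 2, 1, 3.
  append-3-not-in-C : r ≡ 1 → 3 ≤ suc (suc n') → ¬ C (suc (suc n')) (append 3 π)
  append-3-not-in-C r≡1 3≤ (_ , _ , av213) with position 2 (s≤s z≤n) (≤-pred 3≤)
  ... | p₂ , p₂< , e₂ = inversion-below⇒213 3 π p₂<n' n'<length
        (subst₂ _<_ (sym r≡1) (sym e₂) ≤-refl) (subst (_< 3) (sym e₂) ≤-refl) av213
    where
    p₂<n' : p₂ < n'
    p₂<n' = before-last p₂< (λ e → <⇒≢ ≤-refl (trans (sym r≡1) (trans (sym e) e₂)))

  -- Case r ≥ 2: no 2 precedes a 1.  The 1 is not last, so 2, 1, r is a 2-1-3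
  -- unless r = 2, and then the 2 would be last as well.
  two-not-before-one : 2 ≤ r → ¬ Precedes π 2 1
  two-not-before-one 2≤r (i , k , i<k , k< , e₂ , e₁) = by-r (r ≟ 2)
    where
    k<n' : k < n'
    k<n' = before-last k< (λ e → <⇒≱ 2≤r (≤-reflexive (trans (sym e) e₁)))
    by-r : Dec (r ≡ 2) → ⊥
    by-r (yes r≡2) =
      <-irrefl (injective i n' (<-trans i<k k<) n'<length (trans e₂ (sym r≡2))) (<-trans i<k k<n')
    by-r (no  r≢2) = avoids213 i k n' i<k k<n' n'<length
      ( subst₂ _<_ (sym e₁) (sym e₂) ≤-refl
      , subst (_< r) (sym e₂) (≤∧≢⇒< 2≤r (λ e → r≢2 (sym e))) )

  one-before-two : 2 ≤ r → Precedes π 1 2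
  one-before-two 2≤r with position 1 (s≤s z≤n) (≤-trans (s≤s z≤n) (≤-trans 2≤r r≤n))
                        | position 2 (s≤s z≤n) (≤-trans 2≤r r≤n)
  ... | p₁ , p₁< , e₁ | p₂ , p₂< , e₂
      with distinct-positions π (λ e → <⇒≢ ≤-refl (trans (sym e₁) (trans e e₂)))
  ... | inj₁ p₁<p₂ = p₁ , p₂ , p₁<p₂ , p₂< , e₁ , e₂
  ... | inj₂ p₂<p₁ = ⊥-elim (two-not-before-one 2≤r (p₂ , p₁ , p₂<p₁ , p₁< , e₂ , e₁))

  m≡2 : 2 ≤ r → m π ≡ 2
  m≡2 2≤r with one-before-two 2≤r
  ... | p , q , p<q , q< , e₁ , e₂ = m-1-before-2 π entry-pos p<q q< e₁ e₂

  -- Also r ≤ 3: for r ≥ 4 the 3 precedes the 2 (making 3, 2, r a 2-1-3) or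
  -- follows it (then 1, 2, 3 force 3 to be last, i.e. r = 3).
  r≤3 : 2 ≤ r → r ≤ 3
  r≤3 2≤r = ≮⇒≥ r≱4
    where
    r≱4 : ¬ (4 ≤ r)
    r≱4 4≤r with one-before-two 2≤r | position 3 (s≤s z≤n) (≤-trans (<⇒≤ 4≤r) r≤n)
    ... | p₁ , p₂ , p₁<p₂ , p₂< , e₁ , e₂ | p₃ , p₃< , e₃
        with distinct-positions π (λ e → <⇒≢ ≤-refl (trans (sym e₂) (trans e e₃)))
    ... | inj₁ p₂<p₃ =
          <⇒≱ 4≤r (≤-reflexive (trans (cong (at π) (sym p₃≡n')) e₃))
      where
      p₃≡n' : p₃ ≡ n'
      p₃≡n' = 1-2-3-ends p₁<p₂ p₂<p₃ p₃< e₁ e₂ e₃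
    ... | inj₂ p₃<p₂ = avoids213 p₃ p₂ n' p₃<p₂ p₂<n' n'<length
          (subst₂ _<_ (sym e₂) (sym e₃) ≤-refl , subst (_< r) (sym e₃) 4≤r)
      where
      p₂<n' : p₂ < n'
      p₂<n' = before-last p₂< (λ e → <⇒≱ 4≤r (≤-trans (≤-reflexive (trans (sym e) e₂)) (n≤1+n 2)))

  children-last-1 : lastEntry π ≡ 1 → ChildLabels (suc n') π ((suc (m π) , 1) ∷ (2 , 2) ∷ [])
  children-last-1 last≡1 = childLabels-by-values (suc n') π (1 ∷ 2 ∷ []) (((λ ()) ∷ []) ∷ [] ∷ [])
    sound complete (cong₂ _∷_ label-1 (cong₂ _∷_ label-2 refl))
    where
    sound : ∀ {j} → j ∈ 1 ∷ 2 ∷ [] → IsChild (suc n') π (append j π)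
    sound (here refl)         = child-1
    sound (there (here refl)) = child-2
    complete : ∀ {j} → 1 ≤ j → j ≤ suc (suc n') → C (suc (suc n')) (append j π) →
      j ∈ 1 ∷ 2 ∷ []
    complete {1} _ _ _ = here refl
    complete {2} _ _ _ = there (here refl)
    complete {3} _ 3≤ cσ = ⊥-elim (append-3-not-in-C (trans (sym lastEntry≡r) last≡1) 3≤ cσ)
    complete {suc (suc (suc (suc j)))} _ j≤ cσ = ⊥-elim (append-≥4-not-in-C (m≤m+n 4 j) j≤ cσ)

  children-last-≥2 : 2 ≤ lastEntry π → ChildLabels (suc n') π ((3 , 1) ∷ (2 , 2) ∷ (2 , 3) ∷ [])
  children-last-≥2 2≤last = childLabels-by-values (suc n') π (1 ∷ 2 ∷ 3 ∷ [])
    (((λ ()) ∷ (λ ()) ∷ []) ∷ ((λ ()) ∷ []) ∷ [] ∷ []) sound complete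
    (cong₂ _∷_ (trans label-1 (cong (λ x → (suc x , 1)) (m≡2 2≤r)))
      (cong₂ _∷_ label-2 (cong₂ _∷_ (label-3 2≤n (one-before-two 2≤r)) refl)))
    where
    2≤r : 2 ≤ r
    2≤r = subst (2 ≤_) lastEntry≡r 2≤last
    2≤n : 2 ≤ suc n'
    2≤n = ≤-trans 2≤r r≤n
    sound : ∀ {j} → j ∈ 1 ∷ 2 ∷ 3 ∷ [] → IsChild (suc n') π (append j π)
    sound (here refl)                 = child-1
    sound (there (here refl))         = child-2
    sound (there (there (here refl))) = child-3 2≤n (two-not-before-one 2≤r)
    complete : ∀ {j} → 1 ≤ j → j ≤ suc (suc n') → C (suc (suc n')) (append j π) →
      j ∈ 1 ∷ 2 ∷ 3 ∷ []
    complete {1} _ _ _ = here refl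
    complete {2} _ _ _ = there (here refl)
    complete {3} _ _ _ = there (there (here refl))
    complete {suc (suc (suc (suc j)))} _ j≤ cσ = ⊥-elim (append-≥4-not-in-C (m≤m+n 4 j) j≤ cσ)

  -- m < r forces r ≥ 2 (as m ≥ 1), hence m = 2 and r = 3: the previous case.
  children-m<last : m π < lastEntry π →
    ChildLabels (suc n') π ((suc (m π) , 1) ∷ (2 , 2) ∷ labelsFromTo (m π) (m π) (lastEntry π))
  children-m<last m<last = subst (ChildLabels (suc n') π) (sym same-labels) (children-last-≥2 2≤last)
    where
    2≤last : 2 ≤ lastEntry π
    2≤last = ≤-trans (s≤s (m-positive π)) m<last
    2≤r : 2 ≤ r
    2≤r = subst (2 ≤_) lastEntry≡r 2≤last
    m≡2′ : m π ≡ 2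
    m≡2′ = m≡2 2≤r
    last≡3 : lastEntry π ≡ 3
    last≡3 = ≤-antisym (subst (_≤ 3) (sym lastEntry≡r) (r≤3 2≤r))
                       (subst (λ x → suc x ≤ lastEntry π) m≡2′ m<last)
    same-labels : (suc (m π) , 1) ∷ (2 , 2) ∷ labelsFromTo (m π) (m π) (lastEntry π)
                  ≡ (3 , 1) ∷ (2 , 2) ∷ (2 , 3) ∷ []
    same-labels = cong₂ (λ a b → (suc a , 1) ∷ (2 , 2) ∷ labelsFromTo a a b) m≡2′ last≡3

lemma3p8 : (C 1 (1 ∷ []) × label (1 ∷ []) ≡ (2 , 1))
    × (∀ (n : ℕ) (π : List ℕ) → 1 ≤ n → C n π →
        (lastEntry π ≡ 1 → ChildLabels n π ((suc (m π) , 1) ∷ (2 , 2) ∷ []))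
        × (m π ≡ 2 → lastEntry π ≡ 2 → ChildLabels n π ((3 , 1) ∷ (2 , 2) ∷ (2 , 3) ∷ []))
        × (m π < lastEntry π → ChildLabels n π
            ((suc (m π) , 1) ∷ (2 , 2) ∷ labelsFromTo (m π) (m π) (lastEntry π))))
lemma3p8 = (one-in-C , refl) , children
  where
  one-in-C : C 1 (1 ∷ [])
  one-in-C = ↭-refl , (λ { _ _ _ _ _ (s≤s ()) }) , (λ { _ _ zero _ () _ ; _ _ (suc _) _ _ (s≤s ()) })
  children : ∀ (n : ℕ) (π : List ℕ) → 1 ≤ n → C n π →
    (lastEntry π ≡ 1 → ChildLabels n π ((suc (m π) , 1) ∷ (2 , 2) ∷ []))
    × (m π ≡ 2 → lastEntry π ≡ 2 → ChildLabels n π ((3 , 1) ∷ (2 , 2) ∷ (2 , 3) ∷ []))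
    × (m π < lastEntry π → ChildLabels n π
        ((suc (m π) , 1) ∷ (2 , 2) ∷ labelsFromTo (m π) (m π) (lastEntry π)))
  children (suc n') π _ c =
    children-last-1 , (λ _ last≡2 → children-last-≥2 (≤-reflexive (sym last≡2))) , children-m<last
    where open Structure n' π c
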